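{- Let $m,n\ge 1$ be integers and let $F\subset\{1,\dots,m\}\times\{1,\dots,n\}$ be a binary image with row sums $r_i=\#\{j:(i,j)\in F\}$ ($i=1,\dots,m$) and column sums $c_j=\#\{i:(i,j)\in F\}$ ($j=1,\dots,n$), and suppose $r_1=n$ and $r_m=0$. Let $L_h$ be the length of the horizontal boundary of $F$. Define $b_i=\#\{j\in\{1,\dots,n\}: c_j\ge i\}$ and $d_i=b_i-r_i$ for $i=1,\dots,m$. Then for every integer $t\ge 0$ and every choice of indices $1\le i_1<i_2<\dots<i_{2t+1}\le m$ we have \[ L_h \ge 2n + d_{i_1}-d_{i_2}+d_{i_3}-\cdots-d_{i_{2t}}+2d_{i_{2t+1}}, \] \[ L_h \ge 2n - d_{i_{2t+1}}+d_{i_{2t}}-d_{i_{2t-1}}+\cdots+d_{i_2}-2d_{i_1}. \]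
   Context: A binary image is a finite set $F\subset\mathbb{Z}^2$; row $i$ is $\{(x,y):x=i\}$ and column $j$ is $\{(x,y):y=j\}$ (row indices increase downwards, column indices to the right). The horizontal boundary of $F$ is the set of ordered pairs of points $((i,j),(i',j))$ with $|i-i'|=1$, $(i,j)\in F$ and $(i',j)\notin F$ (points of $\mathbb{Z}^2$ outside the $m\times n$ rectangle count as not in $F$, so e.g. a one in row 1 contributes a boundary piece above it); its length is the number of such pairs. -}

module Defs where

open import Data.Bool using (Bool; true; false; if_then_else_; not)
open import Data.Nat using (ℕ; zero; suc; _<?_; _≤ᵇ_)
open import Data.Fin using (Fin; zero; suc; toℕ; fromℕ<)
open import Data.Integer as ℤ using (ℤ; +_)
open import Relation.Nullary using (yes; no)

-- A binary image F ⊆ {1..m} × {1..n} is a Boolean function on Fin m × Fin n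
-- (Fin index k stands for the 1-based index k+1). (i,j) ∈ F  iff  F i j ≡ true.
Image : ℕ → ℕ → Set
Image m n = Fin m → Fin n → Bool

∑ℕ : (k : ℕ) → (Fin k → ℕ) → ℕ
∑ℕ zero    f = 0
∑ℕ (suc k) f = f zero Data.Nat.+ ∑ℕ k (λ x → f (suc x))

∑ℤ : (k : ℕ) → (Fin k → ℤ) → ℤ
∑ℤ zero    f = + 0
∑ℤ (suc k) f = f zero ℤ.+ ∑ℤ k (λ x → f (suc x))

ind : Bool → ℕ
ind true  = 1
ind false = 0

memℕ : ∀ {m n} → Image m n → ℕ → Fin n → Bool
memℕ {m} F i j with i <? m
... | yes p = F (fromℕ< p) j
... | no  _ = false

rowSum : ∀ {m n} → Image m n → Fin m → ℕ
rowSum {n = n} F i = ∑ℕ n (λ j → ind (F i j))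

colSum : ∀ {m n} → Image m n → Fin n → ℕ
colSum {m = m} F j = ∑ℕ m (λ i → ind (F i j))

-- horizontal boundary length: number of ordered pairs ((i,j),(i',j)) with
-- |i - i'| = 1, (i,j) ∈ F, (i',j) ∉ F (outside the rectangle counts as ∉ F).
aboveMissing : ∀ {m n} → Image m n → Fin m → Fin n → ℕ
aboveMissing F zero    j = 1
aboveMissing F (suc i) j = ind (not (memℕ F (toℕ i) j))

belowMissing : ∀ {m n} → Image m n → Fin m → Fin n → ℕ
belowMissing F i j = ind (not (memℕ F (suc (toℕ i)) j))

horizBoundary : ∀ {m n} → Image m n → ℕ
horizBoundary {m} {n} F =
  ∑ℕ m (λ i → ∑ℕ n (λ j →
    if F i j then aboveMissing F i j Data.Nat.+ belowMissing F i j else 0))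

-- b_i = #{ j : c_j ≥ i } for the 1-based row index i = toℕ k + 1
bSeq : ∀ {m n} → Image m n → Fin m → ℕ
bSeq {n = n} F k = ∑ℕ n (λ j → ind (suc (toℕ k) ≤ᵇ colSum F j))

dSeq : ∀ {m n} → Image m n → Fin m → ℤ
dSeq F k = + bSeq F k ℤ.- + rowSum F k

isEven : ℕ → Bool
isEven zero          = true
isEven (suc zero)    = false
isEven (suc (suc k)) = isEven k

-- First bound (0-based position k = 0..2t of the chosen indices):
--   d_{i_1} - d_{i_2} + ... - d_{i_{2t}} + 2 d_{i_{2t+1}}
coeff₁ : (t : ℕ) → Fin (suc (2 Data.Nat.* t)) → ℤ
coeff₁ t k with toℕ k Data.Nat.≡ᵇ (2 Data.Nat.* t)
... | true  = + 2
... | false = if isEven (toℕ k) then + 1 else ℤ.- (+ 1)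

-- Second bound:
--   -2 d_{i_1} + d_{i_2} - d_{i_3} + ... + d_{i_{2t}} - d_{i_{2t+1}}
coeff₂ : (t : ℕ) → Fin (suc (2 Data.Nat.* t)) → ℤ
coeff₂ t zero    = ℤ.- (+ 2)
coeff₂ t (suc k) = if isEven (toℕ k) then + 1 else ℤ.- (+ 1)

-- Work column by column.  In a column let c be its number of ones, sorted u = [u < c] the column
-- with its ones pushed to the top (so summing over columns, sorted gives b and the column itself
-- gives r), and R the number of runs of ones other than the one through the full first row; the
-- column contributes 2 + 2R to L_h.  A potential is a φ such that φ and φ - (sorted - cell) are
-- antitone, 2 (sorted - cell) ≤ φ, 2 + φ ≤ 2 + 2R and 2 - 2 (sorted - cell) + φ ≤ 2 + 2R.  If R = 0
-- the column is sorted and φ = 0 is one; otherwise the number of runs starting below row u, plus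
-- sorted u, is one.  Summed over columns this gives Φ with the same properties for d = b - r and
-- 2n + Φ ≤ L_h.  Grouped into consecutive pairs, d_p - d_q ≤ Φ p - Φ q for p ≤ q makes the
-- alternating sums telescope to at most Φ (i_1), which yields both bounds.
module Submission where

open import Defs
open import Data.Nat using (ℕ; suc; _≤_)
open import Data.Bool using (Bool; true; false; if_then_else_)
open import Relation.Binary.PropositionalEquality using (_≡_)

module Sums where

  open import Data.Nat using (zero; _+_; _*_; _<_; z≤n; s≤s)
  open import Data.Nat.Properties
    using (+-mono-≤; +-assoc; +-identityʳ; *-identityʳ; ≤-reflexive; ≤-trans; m≤m+n; <⇒≢;
           suc-injective; +-0-commutativeMonoid)
  open import Data.Nat.Tactic.RingSolver using (solve-∀)
  open import Data.Fin using (Fin; zero; suc; toℕ)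
  open import Data.Integer as ℤ using (ℤ)
  open import Function using (_∘_)
  open import Relation.Nullary using (contradiction)
  open import Relation.Binary.PropositionalEquality
  open import Algebra.Properties.CommutativeMonoid.Sum +-0-commutativeMonoid
    using (sum; sum-cong-≗; ∑-distrib-+; ∑-comm)

  ∑ℕ≗sum : ∀ n (f : Fin n → ℕ) → ∑ℕ n f ≡ sum f
  ∑ℕ≗sum zero    f = refl
  ∑ℕ≗sum (suc n) f = cong (f zero +_) (∑ℕ≗sum n (f ∘ suc))

  ∑ℕ-cong : ∀ n {f g : Fin n → ℕ} → (∀ i → f i ≡ g i) → ∑ℕ n f ≡ ∑ℕ n g
  ∑ℕ-cong zero    f≗g = refl
  ∑ℕ-cong (suc n) f≗g = cong₂ _+_ (f≗g zero) (∑ℕ-cong n (f≗g ∘ suc))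

  ∑ℤ-cong : ∀ n {f g : Fin n → ℤ} → (∀ i → f i ≡ g i) → ∑ℤ n f ≡ ∑ℤ n g
  ∑ℤ-cong zero    f≗g = refl
  ∑ℤ-cong (suc n) f≗g = cong₂ ℤ._+_ (f≗g zero) (∑ℤ-cong n (f≗g ∘ suc))

  ∑ℕ-mono-≤ : ∀ n {f g : Fin n → ℕ} → (∀ i → f i ≤ g i) → ∑ℕ n f ≤ ∑ℕ n g
  ∑ℕ-mono-≤ zero    f≤g = z≤n
  ∑ℕ-mono-≤ (suc n) f≤g = +-mono-≤ (f≤g zero) (∑ℕ-mono-≤ n (f≤g ∘ suc))

  ∑ℕ-const : ∀ n c → ∑ℕ n (λ _ → c) ≡ n * c
  ∑ℕ-const zero    c = refl
  ∑ℕ-const (suc n) c = cong (c +_) (∑ℕ-const n c)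

  ∑ℕ-distrib-+ : ∀ n (f g : Fin n → ℕ) → ∑ℕ n (λ i → f i + g i) ≡ ∑ℕ n f + ∑ℕ n g
  ∑ℕ-distrib-+ n f g = begin
    ∑ℕ n (λ i → f i + g i)  ≡⟨ ∑ℕ≗sum n (λ i → f i + g i) ⟩
    sum (λ i → f i + g i)   ≡⟨ ∑-distrib-+ f g ⟩
    sum f + sum g           ≡⟨ cong₂ _+_ (∑ℕ≗sum n f) (∑ℕ≗sum n g) ⟨
    ∑ℕ n f + ∑ℕ n g         ∎
    where open ≡-Reasoning

  ∑ℕ-comm : ∀ m n (f : Fin m → Fin n → ℕ) →
            ∑ℕ m (λ i → ∑ℕ n (f i)) ≡ ∑ℕ n (λ j → ∑ℕ m (λ i → f i j))
  ∑ℕ-comm m n f = begin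
    ∑ℕ m (λ i → ∑ℕ n (f i))           ≡⟨ double m n f ⟩
    sum (λ i → sum (f i))             ≡⟨ ∑-comm f ⟩
    sum (λ j → sum (λ i → f i j))     ≡⟨ double n m (λ j i → f i j) ⟨
    ∑ℕ n (λ j → ∑ℕ m (λ i → f i j))   ∎
    where
    open ≡-Reasoning
    double : ∀ m n (f : Fin m → Fin n → ℕ) → ∑ℕ m (λ i → ∑ℕ n (f i)) ≡ sum (λ i → sum (f i))
    double m n f = trans (∑ℕ≗sum m (λ i → ∑ℕ n (f i))) (sum-cong-≗ (λ i → ∑ℕ≗sum n (f i)))

  ind≤1 : ∀ b → ind b ≤ 1
  ind≤1 true  = s≤s z≤n
  ind≤1 false = z≤n

  ∑ℕ-ind≤ : ∀ n (b : Fin n → Bool) → ∑ℕ n (ind ∘ b) ≤ n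
  ∑ℕ-ind≤ n b = subst (∑ℕ n (ind ∘ b) ≤_) (trans (∑ℕ-const n 1) (*-identityʳ n))
                  (∑ℕ-mono-≤ n (ind≤1 ∘ b))

  ∑ℕ-ind-full : ∀ n (b : Fin n → Bool) → ∑ℕ n (ind ∘ b) ≡ n → ∀ j → b j ≡ true
  ∑ℕ-ind-full (suc n) b full j with b zero in b₀ | j
  ... | true  | zero  = b₀
  ... | true  | suc j = ∑ℕ-ind-full n (b ∘ suc) (suc-injective full) j
  ... | false | _     = contradiction full (<⇒≢ (s≤s (∑ℕ-ind≤ n (b ∘ suc))))

  sumBelow : ℕ → (ℕ → ℕ) → ℕ
  sumBelow k g = ∑ℕ k (g ∘ toℕ)

  sumBelow-suc : ∀ k g → sumBelow (suc k) g ≡ sumBelow k g + g k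
  sumBelow-suc zero    g = +-identityʳ (g 0)
  sumBelow-suc (suc k) g =
    trans (cong (g 0 +_) (sumBelow-suc k (g ∘ suc))) (sym (+-assoc (g 0) _ _))

  sumBelow-telescope : ∀ k {f g h : ℕ → ℕ} → (∀ p → f p + g (suc p) ≡ h p + g p) →
                       sumBelow k f + g k ≡ sumBelow k h + g 0
  sumBelow-telescope zero    step = refl
  sumBelow-telescope (suc k) {f} {g} {h} step = begin
    f 0 + F + g (suc k)   ≡⟨ +-assoc (f 0) F _ ⟩
    f 0 + (F + g (suc k)) ≡⟨ cong (f 0 +_) (sumBelow-telescope k {f ∘ suc} {g ∘ suc} {h ∘ suc}
                                                                  (step ∘ suc)) ⟩
    f 0 + (H + g 1)       ≡⟨ swap₁ (f 0) H (g 1) ⟩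
    f 0 + g 1 + H         ≡⟨ cong (_+ H) (step 0) ⟩
    h 0 + g 0 + H         ≡⟨ swap₂ (h 0) (g 0) H ⟩
    h 0 + H + g 0         ∎
    where
    open ≡-Reasoning
    F H : ℕ
    F = sumBelow k (f ∘ suc)
    H = sumBelow k (h ∘ suc)
    swap₁ : ∀ a b c → a + (b + c) ≡ a + c + b
    swap₁ = solve-∀
    swap₂ : ∀ a b c → a + b + c ≡ a + c + b
    swap₂ = solve-∀

  sumBelow-≤-support : ∀ k u {g : ℕ → ℕ} → (∀ p → g p ≤ 1) → (∀ {p} → u ≤ p → g p ≡ 0) →
                       sumBelow k g ≤ u
  sumBelow-≤-support zero    u       bit vanish = z≤n
  sumBelow-≤-support (suc k) zero    bit vanish =
    +-mono-≤ (≤-reflexive (vanish z≤n)) (sumBelow-≤-support k 0 (bit ∘ suc) (λ _ → vanish z≤n))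
  sumBelow-≤-support (suc k) (suc u) bit vanish =
    +-mono-≤ (bit 0) (sumBelow-≤-support k u (bit ∘ suc) (vanish ∘ s≤s))

  sumBelow-≥-ones : ∀ k u {g : ℕ → ℕ} → (∀ {p} → p ≤ u → g p ≡ 1) → u < k →
                    suc u ≤ sumBelow k g
  sumBelow-≥-ones (suc k) zero    one u<k =
    ≤-trans (≤-reflexive (sym (one z≤n))) (m≤m+n _ _)
  sumBelow-≥-ones (suc k) (suc u) one (s≤s u<k) =
    +-mono-≤ (≤-reflexive (sym (one z≤n))) (sumBelow-≥-ones k u (one ∘ s≤s) u<k)

module Integers where

  open import Data.Nat using (_≤′_; ≤′-reflexive; ≤′-step)
  open import Data.Nat.Properties using (≤⇒≤′)
  open import Data.Integer as ℤ using (ℤ; 0ℤ)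
  import Data.Integer.Properties as ℤP
  open import Relation.Binary.PropositionalEquality

  antitone-stepwise : ∀ {f : ℕ → ℤ} → (∀ u → f (suc u) ℤ.≤ f u) → ∀ {p q} → p ≤ q → f q ℤ.≤ f p
  antitone-stepwise {f} step p≤q = go (≤⇒≤′ p≤q)
    where
    go : ∀ {p q} → p ≤′ q → f q ℤ.≤ f p
    go (≤′-reflexive refl) = ℤP.≤-refl
    go (≤′-step p≤′q)     = ℤP.≤-trans (step _) (go p≤′q)

  ≤-by-difference : ∀ {x y x′ y′ : ℤ} → x ℤ.≤ y → y ℤ.- x ≡ y′ ℤ.- x′ → x′ ℤ.≤ y′
  ≤-by-difference x≤y eq = ℤP.0≤i-j⇒j≤i (subst (0ℤ ℤ.≤_) eq (ℤP.i≤j⇒0≤j-i x≤y))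

module Potentials where

  open import Data.Nat using (_+_)
  open import Data.Fin using (Fin)
  open import Data.Integer as ℤ using (ℤ; +_; +≤+)
  import Data.Integer.Properties as ℤP
  open import Data.Integer.Tactic.RingSolver using (solve-∀)
  open import Relation.Binary.PropositionalEquality
  open Sums
  open Integers

  -- With the defect d = sorted - cell, the fields say that φ and φ - d are antitone, 2d ≤ φ,
  -- e + φ ≤ B and e - 2d + φ ≤ B, each with its subtractions moved to the other side.
  record Potential (e B : ℕ) (cell sorted : ℕ → ℕ) : Set where
    field
      φ                 : ℕ → ℕ
      φ-step            : ∀ u → φ (suc u) ≤ φ u
      φ-defect-step     : ∀ u → φ (suc u) + cell (suc u) + sorted u ≤ φ u + cell u + sorted (suc u)
      defect≤φ          : ∀ u → sorted u + sorted u ≤ φ u + (cell u + cell u)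
      φ≤boundary        : ∀ u → e + φ u ≤ B
      φ-defect≤boundary : ∀ u → e + (cell u + cell u) + φ u ≤ B + (sorted u + sorted u)

  ∑-Potential : ∀ n {e B : Fin n → ℕ} {cell sorted : Fin n → ℕ → ℕ} →
                (∀ j → Potential (e j) (B j) (cell j) (sorted j)) →
                Potential (∑ℕ n e) (∑ℕ n B) (λ u → ∑ℕ n (λ j → cell j u))
                          (λ u → ∑ℕ n (λ j → sorted j u))
  ∑-Potential n {e} {B} {cell} {sorted} P = record
    { φ                 = Φ
    ; φ-step            = λ u → ∑ℕ-mono-≤ n (λ j → φ-step (P j) u)
    ; φ-defect-step     = λ u →
        subst₂ _≤_ (∑₃ _ _ _) (∑₃ _ _ _) (∑ℕ-mono-≤ n (λ j → φ-defect-step (P j) u))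
    ; defect≤φ          = λ u →
        subst₂ _≤_ (∑₂ _ _) (∑₁₂ _ _ _) (∑ℕ-mono-≤ n (λ j → defect≤φ (P j) u))
    ; φ≤boundary        = λ u → subst (_≤ ∑ℕ n B) (∑ℕ-distrib-+ n _ _)
        (∑ℕ-mono-≤ n (λ j → φ≤boundary (P j) u))
    ; φ-defect≤boundary = λ u →
        subst₂ _≤_ (trans (∑ℕ-distrib-+ n _ _) (cong (_+ Φ u) (∑₁₂ _ _ _))) (∑₁₂ _ _ _)
          (∑ℕ-mono-≤ n (λ j → φ-defect≤boundary (P j) u))
    }
    where
    open Potential
    Φ : ℕ → ℕ
    Φ u = ∑ℕ n (λ j → φ (P j) u)
    ∑₂ : ∀ f g → ∑ℕ n (λ j → f j + g j) ≡ ∑ℕ n f + ∑ℕ n g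
    ∑₂ = ∑ℕ-distrib-+ n
    ∑₃ : ∀ f g h → ∑ℕ n (λ j → f j + g j + h j) ≡ ∑ℕ n f + ∑ℕ n g + ∑ℕ n h
    ∑₃ f g h = trans (∑₂ _ h) (cong (_+ ∑ℕ n h) (∑₂ f g))
    ∑₁₂ : ∀ f g h → ∑ℕ n (λ j → f j + (g j + h j)) ≡ ∑ℕ n f + (∑ℕ n g + ∑ℕ n h)
    ∑₁₂ f g h = trans (∑₂ f _) (cong (λ s → ∑ℕ n f + s) (∑₂ g h))

  pos-+₃ : ∀ a b c → + (a + b + c) ≡ + a ℤ.+ + b ℤ.+ + c
  pos-+₃ a b c = trans (ℤP.pos-+ (a + b) c) (cong (λ s → s ℤ.+ + c) (ℤP.pos-+ a b))

  pos-+₁₂ : ∀ a b c → + (a + (b + c)) ≡ + a ℤ.+ (+ b ℤ.+ + c)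
  pos-+₁₂ a b c = trans (ℤP.pos-+ a (b + c)) (cong (λ s → + a ℤ.+ s) (ℤP.pos-+ b c))

  module IntegerBounds {e B : ℕ} {cell sorted : ℕ → ℕ} (P : Potential e B cell sorted) where

    open Potential P

    Φ D : ℕ → ℤ
    Φ u = + φ u
    D u = + sorted u ℤ.- + cell u

    Φ-antitone : ∀ {p q} → p ≤ q → Φ q ℤ.≤ Φ p
    Φ-antitone = antitone-stepwise (λ u → +≤+ (φ-step u))

    Φ-D-antitone : ∀ {p q} → p ≤ q → Φ q ℤ.- D q ℤ.≤ Φ p ℤ.- D p
    Φ-D-antitone = antitone-stepwise λ u → ≤-by-difference (+≤+ (φ-defect-step u)) (begin
      + (φ u + cell u + sorted (suc u)) ℤ.- + (φ (suc u) + cell (suc u) + sorted u)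
        ≡⟨ cong₂ ℤ._-_ (pos-+₃ (φ u) (cell u) _) (pos-+₃ (φ (suc u)) (cell (suc u)) _) ⟩
      + φ u ℤ.+ + cell u ℤ.+ + sorted (suc u) ℤ.- (Φ (suc u) ℤ.+ + cell (suc u) ℤ.+ + sorted u)
        ≡⟨ ring (Φ u) (+ cell u) (+ sorted u) (Φ (suc u)) (+ cell (suc u)) (+ sorted (suc u)) ⟩
      Φ u ℤ.- D u ℤ.- (Φ (suc u) ℤ.- D (suc u)) ∎)
      where
      open ≡-Reasoning
      ring : ∀ f c s f′ c′ s′ → f ℤ.+ c ℤ.+ s′ ℤ.- (f′ ℤ.+ c′ ℤ.+ s)
                                ≡ f ℤ.- (s ℤ.- c) ℤ.- (f′ ℤ.- (s′ ℤ.- c′))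
      ring = solve-∀

    2D≤Φ : ∀ u → + 2 ℤ.* D u ℤ.≤ Φ u
    2D≤Φ u = ≤-by-difference (+≤+ (defect≤φ u))
      (trans (cong₂ ℤ._-_ (pos-+₁₂ (φ u) (cell u) (cell u)) (ℤP.pos-+ (sorted u) (sorted u)))
             (ring (Φ u) (+ cell u) (+ sorted u)))
      where
      ring : ∀ f c s → f ℤ.+ (c ℤ.+ c) ℤ.- (s ℤ.+ s) ≡ f ℤ.- + 2 ℤ.* (s ℤ.- c)
      ring = solve-∀

    e+Φ≤B : ∀ u → + e ℤ.+ Φ u ℤ.≤ + B
    e+Φ≤B u = subst (ℤ._≤ + B) (ℤP.pos-+ e (φ u)) (+≤+ (φ≤boundary u))

    e-2D+Φ≤B : ∀ u → + e ℤ.+ (ℤ.- + 2 ℤ.* D u ℤ.+ Φ u) ℤ.≤ + B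
    e-2D+Φ≤B u = ≤-by-difference (+≤+ (φ-defect≤boundary u))
      (trans (cong₂ ℤ._-_ (pos-+₁₂ B (sorted u) (sorted u)) (pos-+₃ e (cell u + cell u) (φ u)))
             (trans (cong (λ s → + B ℤ.+ (+ sorted u ℤ.+ + sorted u) ℤ.- (+ e ℤ.+ s ℤ.+ Φ u))
                          (ℤP.pos-+ (cell u) (cell u)))
                    (ring (+ B) (+ sorted u) (+ e) (+ cell u) (Φ u))))
      where
      ring : ∀ b s e c f → b ℤ.+ (s ℤ.+ s) ℤ.- (e ℤ.+ (c ℤ.+ c) ℤ.+ f)
                           ≡ b ℤ.- (e ℤ.+ (ℤ.- + 2 ℤ.* (s ℤ.- c) ℤ.+ f))
      ring = solve-∀

module Column (m : ℕ) (X : ℕ → Bool) (top : X 0 ≡ true)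
              (bottom : ∀ {p} → suc m ≤ p → X p ≡ false) where

  open import Data.Nat using (zero; _+_; _∸_; _<_; _≤ᵇ_; z≤n; s≤s)
  open import Data.Nat.Properties
  open import Data.Nat.Tactic.RingSolver using (solve-∀)
  open import Data.Bool using (not; _∧_; T)
  open import Data.Bool.Properties using (∧-zeroʳ)
  open import Data.Unit using (tt)
  open import Data.Fin using (toℕ)
  open import Data.Product using (_×_; _,_)
  open import Data.Sum using (_⊎_; inj₁; inj₂)
  open import Function using (_∘_)
  open import Relation.Nullary using (contradiction)
  open import Relation.Binary.PropositionalEquality
  open Sums
  open Potentials

  cell : ℕ → ℕ
  cell p = ind (X p)

  count : ℕ
  count = sumBelow (suc m) cell

  sorted : ℕ → ℕ
  sorted p = ind (suc p ≤ᵇ count)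

  runStart : ℕ → ℕ
  runStart p = ind (not (X p) ∧ X (suc p))

  runStartsFrom : ℕ → ℕ
  runStartsFrom u = sumBelow (suc m) (λ k → runStart (u + k))

  runStarts : ℕ
  runStarts = runStartsFrom 0

  missingAbove : ℕ → ℕ
  missingAbove zero    = 1
  missingAbove (suc p) = ind (not (X p))

  missingBelow : ℕ → ℕ
  missingBelow p = ind (not (X (suc p)))

  boundary : ℕ
  boundary = sumBelow (suc m) (λ p → if X p then missingAbove p + missingBelow p else 0)

  noRunStart-down : ∀ p → runStart p ≡ 0 → X p ≡ false → X (suc p) ≡ false
  noRunStart-down p none Xp with X p | X (suc p)
  noRunStart-down p ()   Xp | false | true
  noRunStart-down p none () | true  | _
  ... | false | false = refl

  noRunStart-up : ∀ p → runStart p ≡ 0 → X (suc p) ≡ true → X p ≡ true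
  noRunStart-up p none Xsp with X p | X (suc p)
  noRunStart-up p ()   Xsp | false | true
  noRunStart-up p none ()  | false | false
  ... | true | _ = refl

  cell-step : ∀ p → cell (suc p) ≤ runStart p + cell p
  cell-step p with X p | X (suc p)
  ... | true  | true  = s≤s z≤n
  ... | true  | false = z≤n
  ... | false | true  = s≤s z≤n
  ... | false | false = z≤n

  runStart-beyond : ∀ {p} → m ≤ p → runStart p ≡ 0
  runStart-beyond {p} m≤p rewrite bottom (s≤s m≤p) | ∧-zeroʳ (not (X p)) = refl

  runStartsFrom-suc : ∀ u → runStartsFrom u ≡ runStart u + runStartsFrom (suc u)
  runStartsFrom-suc u = begin
    runStartsFrom u                          ≡⟨ +-identityʳ (runStartsFrom u) ⟨
    runStartsFrom u + 0                      ≡⟨ cong (runStartsFrom u +_) beyond ⟨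
    runStartsFrom u + runStart (u + suc m)   ≡⟨ sumBelow-suc (suc m) (λ k → runStart (u + k)) ⟨
    runStart (u + 0) + sumBelow (suc m) (λ k → runStart (u + suc k))
      ≡⟨ cong₂ _+_ (cong runStart (+-identityʳ u))
                   (∑ℕ-cong (suc m) (λ k → cong runStart (+-suc u (toℕ k)))) ⟩
    runStart u + runStartsFrom (suc u)       ∎
    where
    open ≡-Reasoning
    beyond : runStart (u + suc m) ≡ 0
    beyond = runStart-beyond (≤-trans (n≤1+n m) (m≤n+m (suc m) u))

  runStarts-split : ∀ u → runStarts ≡ sumBelow u runStart + runStartsFrom u
  runStarts-split zero    = refl
  runStarts-split (suc u) = begin
    runStarts                                 ≡⟨ runStarts-split u ⟩
    S + runStartsFrom u                       ≡⟨ cong (S +_) (runStartsFrom-suc u) ⟩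
    S + (runStart u + runStartsFrom (suc u))  ≡⟨ +-assoc S (runStart u) _ ⟨
    S + runStart u + runStartsFrom (suc u)    ≡⟨ cong (_+ runStartsFrom (suc u)) (sumBelow-suc u runStart) ⟨
    sumBelow (suc u) runStart + runStartsFrom (suc u) ∎
    where
    open ≡-Reasoning
    S : ℕ
    S = sumBelow u runStart

  runStartsFrom≤runStarts : ∀ u → runStartsFrom u ≤ runStarts
  runStartsFrom≤runStarts u = subst (runStartsFrom u ≤_) (sym (runStarts-split u))
                                (m≤n+m _ (sumBelow u runStart))

  noRunStartFrom⇒empty : ∀ u → runStartsFrom u ≡ 0 → X u ≡ false → ∀ k → X (u + k) ≡ false
  noRunStartFrom⇒empty u none Xu zero    = subst (λ p → X p ≡ false) (sym (+-identityʳ u)) Xu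
  noRunStartFrom⇒empty u none Xu (suc k) =
    subst (λ p → X p ≡ false) (sym (+-suc u k))
      (noRunStartFrom⇒empty (suc u) (m+n≡0⇒n≡0 (runStart u) none′)
        (noRunStart-down u (m+n≡0⇒m≡0 (runStart u) none′) Xu) k)
    where
    none′ : runStart u + runStartsFrom (suc u) ≡ 0
    none′ = trans (sym (runStartsFrom-suc u)) none

  noRunStartBelow⇒full : ∀ u → sumBelow u runStart ≡ 0 → X u ≡ true → ∀ {p} → p ≤ u → X p ≡ true
  noRunStartBelow⇒full zero    _    Xu z≤n = Xu
  noRunStartBelow⇒full (suc u) none Xsu p≤su with m≤n⇒m<n∨m≡n p≤su
  ... | inj₂ refl       = Xsu
  ... | inj₁ (s≤s p≤u) =
    noRunStartBelow⇒full u (m+n≡0⇒m≡0 (sumBelow u runStart) none′)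
      (noRunStart-up u (m+n≡0⇒n≡0 (sumBelow u runStart) none′) Xsu) p≤u
    where
    none′ : sumBelow u runStart + runStart u ≡ 0
    none′ = trans (sym (sumBelow-suc u runStart)) none

  sorted-cases : ∀ p → (p < count × sorted p ≡ 1) ⊎ (count ≤ p × sorted p ≡ 0)
  sorted-cases p with suc p ≤ᵇ count in eq
  ... | true  = inj₁ (≤ᵇ⇒≤ (suc p) count (subst T (sym eq) tt) , refl)
  ... | false = inj₂ (≮⇒≥ (λ p<count → subst T eq (≤⇒≤ᵇ p<count)) , refl)

  sorted-step : ∀ p → sorted (suc p) ≤ sorted p
  sorted-step p with sorted-cases (suc p) | sorted-cases p
  ... | inj₂ (_ , s≡0)       | _                    = subst (_≤ sorted p) (sym s≡0) z≤n
  ... | inj₁ (_ , s≡1)       | inj₁ (_ , s′≡1)      = ≤-reflexive (trans s≡1 (sym s′≡1))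
  ... | inj₁ (sp<count , _)  | inj₂ (count≤p , _) =
    contradiction (<-trans (n<1+n p) sp<count) (≤⇒≯ count≤p)

  sorted≤1 : ∀ p → sorted p ≤ 1
  sorted≤1 p = ind≤1 (suc p ≤ᵇ count)

  sorted≤runStartsFrom+cell : ∀ u → sorted u ≤ runStartsFrom u + cell u
  sorted≤runStartsFrom+cell u with X u in Xu | runStartsFrom u in none
  ... | true  | _     = ≤-trans (sorted≤1 u) (m≤n+m 1 _)
  ... | false | suc _ = ≤-trans (sorted≤1 u) (s≤s z≤n)
  ... | false | zero with sorted-cases u
  ...   | inj₂ (_ , s≡0)      = ≤-reflexive s≡0
  ...   | inj₁ (u<count , _) = contradiction u<count (≤⇒≯ count≤u)
    where
    count≤u : count ≤ u
    count≤u = sumBelow-≤-support (suc m) u (ind≤1 ∘ X) λ {p} u≤p →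
      cong ind (subst (λ q → X q ≡ false) (m+[n∸m]≡n u≤p)
                      (noRunStartFrom⇒empty u none Xu (p ∸ u)))

  inImage : ∀ {u} → X u ≡ true → u < suc m
  inImage Xu = ≰⇒> λ sm≤u → true≢false (trans (sym Xu) (bottom sm≤u))
    where
    true≢false : true ≢ false
    true≢false ()

  overflow⇒runStartAbove : ∀ u → count ≤ u → X u ≡ true → 1 ≤ sumBelow u runStart
  overflow⇒runStartAbove u count≤u Xu with sumBelow u runStart in none
  ... | suc _ = s≤s z≤n
  ... | zero  = contradiction (sumBelow-≥-ones (suc m) u full (inImage Xu)) (≤⇒≯ count≤u)
    where
    full : ∀ {p} → p ≤ u → cell p ≡ 1
    full p≤u = cong ind (noRunStartBelow⇒full u none Xu p≤u)

  cell+runStartsFrom≤runStarts+sorted : ∀ u → cell u + runStartsFrom u ≤ runStarts + sorted u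
  cell+runStartsFrom≤runStarts+sorted u with X u in Xu
  ... | false = ≤-trans (runStartsFrom≤runStarts u) (m≤m+n _ _)
  ... | true with sorted-cases u
  ...   | inj₁ (_ , s≡1) =
    subst (suc (runStartsFrom u) ≤_) (trans (+-comm 1 runStarts) (cong (runStarts +_) (sym s≡1)))
      (s≤s (runStartsFrom≤runStarts u))
  ...   | inj₂ (count≤u , s≡0) = begin
    1 + runStartsFrom u                      ≤⟨ +-monoˡ-≤ _ (overflow⇒runStartAbove u count≤u Xu) ⟩
    sumBelow u runStart + runStartsFrom u    ≡⟨ runStarts-split u ⟨
    runStarts                                ≡⟨ +-identityʳ runStarts ⟨
    runStarts + 0                            ≡⟨ cong (runStarts +_) s≡0 ⟨
    runStarts + sorted u                     ∎
    where open ≤-Reasoning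

  runStarts≡sumBelow : runStarts ≡ sumBelow m runStart
  runStarts≡sumBelow = begin
    sumBelow (suc m) runStart          ≡⟨ sumBelow-suc m runStart ⟩
    sumBelow m runStart + runStart m   ≡⟨ cong (sumBelow m runStart +_) (runStart-beyond ≤-refl) ⟩
    sumBelow m runStart + 0            ≡⟨ +-identityʳ _ ⟩
    sumBelow m runStart                ∎
    where open ≡-Reasoning

  opening closing : ℕ → ℕ
  opening p = if X p then missingAbove p else 0
  closing p = if X p then missingBelow p else 0

  opening-suc : ∀ p → opening (suc p) ≡ runStart p
  opening-suc p with X p | X (suc p)
  ... | true  | true  = refl
  ... | true  | false = refl
  ... | false | true  = refl
  ... | false | false = refl

  closing-telescope : ∀ p → closing p + cell (suc p) ≡ runStart p + cell p
  closing-telescope p with X p | X (suc p)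
  ... | true  | true  = refl
  ... | true  | false = refl
  ... | false | true  = refl
  ... | false | false = refl

  boundary≡ : boundary ≡ 2 + (runStarts + runStarts)
  boundary≡ = begin
    boundary
      ≡⟨ ∑ℕ-cong (suc m) (λ i → split (toℕ i)) ⟩
    sumBelow (suc m) (λ p → opening p + closing p)
      ≡⟨ ∑ℕ-distrib-+ (suc m) (opening ∘ toℕ) (closing ∘ toℕ) ⟩
    sumBelow (suc m) opening + sumBelow (suc m) closing
      ≡⟨ cong₂ _+_ openings closings ⟩
    1 + runStarts + (runStarts + 1)
      ≡⟨ ring runStarts ⟩
    2 + (runStarts + runStarts) ∎
    where
    open ≡-Reasoning
    split : ∀ p → (if X p then missingAbove p + missingBelow p else 0) ≡ opening p + closing p
    split p with X p
    ... | true  = refl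
    ... | false = refl
    openings : sumBelow (suc m) opening ≡ 1 + runStarts
    openings = cong₂ _+_ (cong (λ b → if b then 1 else 0) top)
                         (trans (∑ℕ-cong m (opening-suc ∘ toℕ)) (sym runStarts≡sumBelow))
    closings : sumBelow (suc m) closing ≡ runStarts + 1
    closings = begin
      sumBelow (suc m) closing
        ≡⟨ +-identityʳ (sumBelow (suc m) closing) ⟨
      sumBelow (suc m) closing + 0
        ≡⟨ cong (λ b → sumBelow (suc m) closing + ind b) (bottom ≤-refl) ⟨
      sumBelow (suc m) closing + cell (suc m)
        ≡⟨ sumBelow-telescope (suc m) {closing} {cell} {runStart} closing-telescope ⟩
      runStarts + cell 0
        ≡⟨ cong (λ b → runStarts + ind b) top ⟩
      runStarts + 1 ∎
    ring : ∀ r → 1 + r + (r + 1) ≡ 2 + (r + r)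
    ring = solve-∀

  2≤boundary : 2 ≤ boundary
  2≤boundary = subst (2 ≤_) (sym boundary≡) (m≤m+n 2 _)

  runStartsFrom-step : ∀ u → runStartsFrom (suc u) ≤ runStartsFrom u
  runStartsFrom-step u = subst (runStartsFrom (suc u) ≤_) (sym (runStartsFrom-suc u))
                           (m≤n+m _ (runStart u))

  cell≡sorted : runStarts ≡ 0 → ∀ u → cell u ≡ sorted u
  cell≡sorted none u = ≤-antisym cell≤sorted sorted≤cell
    where
    none-from-u : runStartsFrom u ≡ 0
    none-from-u = n≤0⇒n≡0 (subst (runStartsFrom u ≤_) none (runStartsFrom≤runStarts u))
    sorted≤cell : sorted u ≤ cell u
    sorted≤cell = subst (λ a → sorted u ≤ a + cell u) none-from-u (sorted≤runStartsFrom+cell u)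
    cell≤sorted : cell u ≤ sorted u
    cell≤sorted = subst (_≤ sorted u) (+-identityʳ (cell u))
      (subst₂ (λ a r → cell u + a ≤ r + sorted u) none-from-u none
        (cell+runStartsFrom≤runStarts+sorted u))

  sortedPotential : runStarts ≡ 0 → Potential 2 boundary cell sorted
  sortedPotential none = record
    { φ                 = λ _ → 0
    ; φ-step            = λ _ → z≤n
    ; φ-defect-step     = λ u →
        ≤-reflexive (trans (cong₂ _+_ (same (suc u)) (sym (same u))) (+-comm _ (cell u)))
    ; defect≤φ          = λ u → ≤-reflexive (sym (cong₂ _+_ (same u) (same u)))
    ; φ≤boundary        = λ _ → 2≤boundary
    ; φ-defect≤boundary = λ u → begin
        2 + (cell u + cell u) + 0      ≡⟨ +-identityʳ _ ⟩
        2 + (cell u + cell u)          ≡⟨ cong (λ c → 2 + (c + c)) (same u) ⟩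
        2 + (sorted u + sorted u)      ≤⟨ +-monoˡ-≤ _ 2≤boundary ⟩
        boundary + (sorted u + sorted u) ∎
    }
    where
    open ≤-Reasoning
    same : ∀ u → cell u ≡ sorted u
    same = cell≡sorted none

  unsortedPotential : 1 ≤ runStarts → Potential 2 boundary cell sorted
  unsortedPotential some = record
    { φ                 = φ
    ; φ-step            = λ u → +-mono-≤ (runStartsFrom-step u) (sorted-step u)
    ; φ-defect-step     = φ-defect-step
    ; defect≤φ          = defect≤φ
    ; φ≤boundary        = λ u → begin
        2 + φ u                     ≤⟨ +-monoʳ-≤ 2 (+-mono-≤ (runStartsFrom≤runStarts u)
                                                             (≤-trans (sorted≤1 u) some)) ⟩
        2 + (runStarts + runStarts) ≡⟨ boundary≡ ⟨
        boundary                    ∎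
    ; φ-defect≤boundary = φ-defect≤boundary
    }
    where
    open ≤-Reasoning
    φ : ℕ → ℕ
    φ u = runStartsFrom u + sorted u

    φ-defect-step : ∀ u → φ (suc u) + cell (suc u) + sorted u ≤ φ u + cell u + sorted (suc u)
    φ-defect-step u = begin
      φ (suc u) + cell (suc u) + sorted u
        ≤⟨ +-monoˡ-≤ (sorted u) (+-monoʳ-≤ (φ (suc u)) (cell-step u)) ⟩
      φ (suc u) + (runStart u + cell u) + sorted u
        ≡⟨ ring (runStartsFrom (suc u)) (sorted (suc u)) (runStart u) (cell u) (sorted u) ⟩
      runStart u + runStartsFrom (suc u) + sorted u + cell u + sorted (suc u)
        ≡⟨ cong (λ a → a + sorted u + cell u + sorted (suc u)) (runStartsFrom-suc u) ⟨
      φ u + cell u + sorted (suc u) ∎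
      where
      ring : ∀ a s′ r c s → a + s′ + (r + c) + s ≡ r + a + s + c + s′
      ring = solve-∀

    defect≤φ : ∀ u → sorted u + sorted u ≤ φ u + (cell u + cell u)
    defect≤φ u = begin
      sorted u + sorted u
        ≤⟨ +-monoˡ-≤ (sorted u) (sorted≤runStartsFrom+cell u) ⟩
      runStartsFrom u + cell u + sorted u
        ≤⟨ m≤m+n _ (cell u) ⟩
      runStartsFrom u + cell u + sorted u + cell u
        ≡⟨ ring (runStartsFrom u) (cell u) (sorted u) ⟩
      φ u + (cell u + cell u) ∎
      where
      ring : ∀ a c s → a + c + s + c ≡ a + s + (c + c)
      ring = solve-∀

    φ-defect≤boundary : ∀ u → 2 + (cell u + cell u) + φ u ≤ boundary + (sorted u + sorted u)
    φ-defect≤boundary u = begin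
      2 + (cell u + cell u) + φ u
        ≡⟨ ring₁ (cell u) (runStartsFrom u) (sorted u) ⟩
      2 + (cell u + (cell u + runStartsFrom u)) + sorted u
        ≤⟨ +-monoˡ-≤ (sorted u) (+-monoʳ-≤ 2 (+-mono-≤ (≤-trans (ind≤1 (X u)) some)
                                                    (cell+runStartsFrom≤runStarts+sorted u))) ⟩
      2 + (runStarts + (runStarts + sorted u)) + sorted u
        ≡⟨ ring₂ runStarts (sorted u) ⟩
      2 + (runStarts + runStarts) + (sorted u + sorted u)
        ≡⟨ cong (_+ (sorted u + sorted u)) boundary≡ ⟨
      boundary + (sorted u + sorted u) ∎
      where
      ring₁ : ∀ c a s → 2 + (c + c) + (a + s) ≡ 2 + (c + (c + a)) + s
      ring₁ = solve-∀
      ring₂ : ∀ r s → 2 + (r + (r + s)) + s ≡ 2 + (r + r) + (s + s)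
      ring₂ = solve-∀

  potential : Potential 2 boundary cell sorted
  potential with runStarts in eq
  ... | zero  = sortedPotential eq
  ... | suc _ = unsortedPotential (subst (1 ≤_) (sym eq) (s≤s z≤n))

open import Data.Integer as ℤ using (ℤ; +_)

module Signs where

  open import Data.Nat using (zero; _+_; _*_; _≡ᵇ_)
  open import Data.Nat.Properties using (+-identityʳ; +-suc)
  open import Data.Fin using (toℕ)
  open import Relation.Binary.PropositionalEquality

  sign : ℕ → ℤ
  sign p = if isEven p then + 1 else ℤ.- (+ 1)

  lastDoubled : ℕ → ℕ → ℤ
  lastDoubled N p = if p ≡ᵇ N then + 2 else sign p

  isEven-double : ∀ t → isEven (2 * t) ≡ true
  isEven-double t rewrite +-identityʳ t = isEven-+-self t
    where
    isEven-+-self : ∀ t → isEven (t + t) ≡ true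
    isEven-+-self zero    = refl
    isEven-+-self (suc t) rewrite +-suc t t = isEven-+-self t

  coeff₁≡lastDoubled : ∀ t k → coeff₁ t k ≡ lastDoubled (2 * t) (toℕ k)
  coeff₁≡lastDoubled t k with toℕ k ≡ᵇ 2 * t
  ... | true  = refl
  ... | false = refl

module Alternating {A : Set} (_≼_ : A → A → Set) (Φ D : A → ℤ)
  (Φ-antitone   : ∀ {p q} → p ≼ q → Φ q ℤ.≤ Φ p)
  (Φ-D-antitone : ∀ {p q} → p ≼ q → Φ q ℤ.- D q ℤ.≤ Φ p ℤ.- D p) where

  open import Data.Nat using (zero; z≤n; s≤s)
  open import Data.Fin using (Fin; zero; suc; toℕ; _<_)
  import Data.Integer.Properties as ℤP
  open import Data.Integer.Tactic.RingSolver using (solve-∀)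
  open import Relation.Binary.PropositionalEquality
  open Integers using (≤-by-difference)
  open Signs

  pair≤ : ∀ {w u₀ u₁ S} → w ≼ u₀ → u₀ ≼ u₁ → S ℤ.≤ Φ u₁ →
          + 1 ℤ.* D u₀ ℤ.+ (ℤ.- (+ 1) ℤ.* D u₁ ℤ.+ S) ℤ.≤ Φ w
  pair≤ {w} {u₀} {u₁} {S} w≼u₀ u₀≼u₁ S≤ = begin
    + 1 ℤ.* D u₀ ℤ.+ (ℤ.- (+ 1) ℤ.* D u₁ ℤ.+ S) ≡⟨ ring₁ (D u₀) (D u₁) S ⟩
    D u₀ ℤ.- D u₁ ℤ.+ S                         ≤⟨ ℤP.+-mono-≤ drop S≤ ⟩
    Φ u₀ ℤ.- Φ u₁ ℤ.+ Φ u₁                      ≡⟨ ring₂ (Φ u₀) (Φ u₁) ⟩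
    Φ u₀                                        ≤⟨ Φ-antitone w≼u₀ ⟩
    Φ w                                         ∎
    where
    open ℤP.≤-Reasoning
    ring₁ : ∀ d₀ d₁ s → + 1 ℤ.* d₀ ℤ.+ (ℤ.- (+ 1) ℤ.* d₁ ℤ.+ s) ≡ d₀ ℤ.- d₁ ℤ.+ s
    ring₁ = solve-∀
    ring₂ : ∀ f₀ f₁ → f₀ ℤ.- f₁ ℤ.+ f₁ ≡ f₀
    ring₂ = solve-∀
    ring₃ : ∀ f₀ f₁ d₀ d₁ → f₀ ℤ.- d₀ ℤ.- (f₁ ℤ.- d₁) ≡ f₀ ℤ.- f₁ ℤ.- (d₀ ℤ.- d₁)
    ring₃ = solve-∀
    drop : D u₀ ℤ.- D u₁ ℤ.≤ Φ u₀ ℤ.- Φ u₁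
    drop = ≤-by-difference (Φ-D-antitone u₀≼u₁) (ring₃ (Φ u₀) (Φ u₁) (D u₀) (D u₁))

  alternating≤ : (∀ u → + 0 ℤ.≤ Φ u) →
                 ∀ N → isEven N ≡ true → (idx : Fin N → A) → (∀ k l → k < l → idx k ≼ idx l) →
                 ∀ {w} → (∀ k → w ≼ idx k) → ∑ℤ N (λ k → sign (toℕ k) ℤ.* D (idx k)) ℤ.≤ Φ w
  alternating≤ Φ≥0 zero          _    idx sorted {w} w≼ = Φ≥0 w
  alternating≤ Φ≥0 (suc (suc N)) even idx sorted w≼ =
    pair≤ (w≼ zero) (sorted zero (suc zero) (s≤s z≤n))
      (alternating≤ Φ≥0 N even (λ k → idx (suc (suc k))) (λ k l k<l → sorted _ _ (s≤s (s≤s k<l)))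
        (λ k → sorted (suc zero) (suc (suc k)) (s≤s (s≤s z≤n))))

  alternatingDoubled≤ : (∀ u → + 2 ℤ.* D u ℤ.≤ Φ u) →
                        ∀ N → isEven N ≡ true → (idx : Fin (suc N) → A) →
                        (∀ k l → k < l → idx k ≼ idx l) → ∀ {w} → w ≼ idx zero →
                        ∑ℤ (suc N) (λ k → lastDoubled N (toℕ k) ℤ.* D (idx k)) ℤ.≤ Φ w
  alternatingDoubled≤ 2D≤Φ zero          _    idx sorted w≼ =
    ℤP.≤-trans (ℤP.≤-reflexive (ℤP.+-identityʳ _)) (ℤP.≤-trans (2D≤Φ (idx zero)) (Φ-antitone w≼))
  alternatingDoubled≤ 2D≤Φ (suc (suc N)) even idx sorted w≼ =
    pair≤ w≼ (sorted zero (suc zero) (s≤s z≤n))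
      (alternatingDoubled≤ 2D≤Φ N even (λ k → idx (suc (suc k)))
        (λ k l k<l → sorted _ _ (s≤s (s≤s k<l)))
        (sorted (suc zero) (suc (suc zero)) (s≤s (s≤s z≤n))))

open import Data.Fin using (Fin; zero; toℕ)

module ImageBounds {m n : ℕ} (F : Image (suc m) n) (topRow : rowSum F zero ≡ n) where

  open import Data.Nat using (_+_; _*_; _<?_; _≤ᵇ_; z≤n; s≤s)
  open import Data.Nat.Properties using (*-comm; <⇒≱; <⇒≤; ≤-refl)
  open import Data.Fin using (suc) renaming (_≤_ to _≤ᶠ_; _<_ to _<ᶠ_)
  open import Data.Fin.Properties using (toℕ<n; fromℕ<-toℕ)
  import Data.Integer.Properties as ℤP
  open import Data.Empty using (⊥-elim)
  open import Function using (_∘_)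
  open import Relation.Nullary using (yes; no)
  open import Relation.Binary.PropositionalEquality
  open Sums
  open Potentials
  open Signs

  memℕ-toℕ : ∀ i j → memℕ F (toℕ i) j ≡ F i j
  memℕ-toℕ i j with toℕ i <? suc m
  ... | yes i<m = cong (λ i′ → F i′ j) (fromℕ<-toℕ i i<m)
  ... | no  i≮m = ⊥-elim (i≮m (toℕ<n i))

  memℕ-beyond : ∀ j {p} → suc m ≤ p → memℕ F p j ≡ false
  memℕ-beyond j {p} m<p with p <? suc m
  ... | yes p<m = ⊥-elim (<⇒≱ p<m m<p)
  ... | no  _   = refl

  topRow-full : ∀ j → memℕ F 0 j ≡ true
  topRow-full j = trans (memℕ-toℕ zero j) (∑ℕ-ind-full n (F zero) topRow j)

  module ColumnOf (j : Fin n) = Column m (λ p → memℕ F p j) (topRow-full j) (memℕ-beyond j)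

  potential : Potential (∑ℕ n (λ _ → 2)) (∑ℕ n ColumnOf.boundary)
                        (λ u → ∑ℕ n (λ j → ColumnOf.cell j u))
                        (λ u → ∑ℕ n (λ j → ColumnOf.sorted j u))
  potential = ∑-Potential n ColumnOf.potential

  open IntegerBounds potential

  horizBoundary≡ : horizBoundary F ≡ ∑ℕ n ColumnOf.boundary
  horizBoundary≡ = trans (∑ℕ-comm (suc m) n cellBoundary) (∑ℕ-cong n λ j → ∑ℕ-cong (suc m) λ i →
    cong₂ (λ b a → if b then a + belowMissing F i j else 0)
          (sym (memℕ-toℕ i j)) (aboveMissing≡ i j))
    where
    cellBoundary : Fin (suc m) → Fin n → ℕ
    cellBoundary i j = if F i j then aboveMissing F i j + belowMissing F i j else 0
    aboveMissing≡ : ∀ i j → aboveMissing F i j ≡ ColumnOf.missingAbove j (toℕ i)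
    aboveMissing≡ zero    j = refl
    aboveMissing≡ (suc i) j = refl

  dSeq≡D : ∀ i → dSeq F i ≡ D (toℕ i)
  dSeq≡D i = cong₂ (λ b r → + b ℤ.- + r)
    (∑ℕ-cong n λ j → cong (λ c → ind (suc (toℕ i) ≤ᵇ c)) (colSum≡count j))
    (∑ℕ-cong n λ j → cong ind (sym (memℕ-toℕ i j)))
    where
    colSum≡count : ∀ j → colSum F j ≡ ColumnOf.count j
    colSum≡count j = ∑ℕ-cong (suc m) λ i → cong ind (sym (memℕ-toℕ i j))

  Φ-dSeq-antitone : ∀ {i j} → i ≤ᶠ j → Φ (toℕ j) ℤ.- dSeq F j ℤ.≤ Φ (toℕ i) ℤ.- dSeq F i
  Φ-dSeq-antitone {i} {j} i≤j rewrite dSeq≡D i | dSeq≡D j = Φ-D-antitone i≤j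

  2dSeq≤Φ : ∀ i → + 2 ℤ.* dSeq F i ℤ.≤ Φ (toℕ i)
  2dSeq≤Φ i rewrite dSeq≡D i = 2D≤Φ (toℕ i)

  2n≡ : 2 * n ≡ ∑ℕ n (λ _ → 2)
  2n≡ = trans (*-comm 2 n) (sym (∑ℕ-const n 2))

  2n+Φ≤L : ∀ (i : Fin (suc m)) → + (2 * n) ℤ.+ Φ (toℕ i) ℤ.≤ + horizBoundary F
  2n+Φ≤L i rewrite 2n≡ | horizBoundary≡ = e+Φ≤B (toℕ i)

  2n-2dSeq+Φ≤L : ∀ i → + (2 * n) ℤ.+ (ℤ.- + 2 ℤ.* dSeq F i ℤ.+ Φ (toℕ i)) ℤ.≤ + horizBoundary F
  2n-2dSeq+Φ≤L i rewrite 2n≡ | horizBoundary≡ | dSeq≡D i = e-2D+Φ≤B (toℕ i)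

  open Alternating (_≤ᶠ_ {suc m}) (Φ ∘ toℕ) (dSeq F) Φ-antitone Φ-dSeq-antitone

  module _ (t : ℕ) (idx : Fin (suc (2 * t)) → Fin (suc m))
           (increasing : ∀ k l → k <ᶠ l → idx k <ᶠ idx l) where

    open ℤP.≤-Reasoning

    bound₁ : + (2 * n) ℤ.+ ∑ℤ (suc (2 * t)) (λ k → coeff₁ t k ℤ.* dSeq F (idx k))
             ℤ.≤ + horizBoundary F
    bound₁ = begin
      + (2 * n) ℤ.+ ∑ℤ (suc (2 * t)) (λ k → coeff₁ t k ℤ.* dSeq F (idx k))
        ≡⟨ cong (λ s → + (2 * n) ℤ.+ s) (∑ℤ-cong (suc (2 * t)) λ k →
             cong (λ c → c ℤ.* dSeq F (idx k)) (coeff₁≡lastDoubled t k)) ⟩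
      + (2 * n) ℤ.+ ∑ℤ (suc (2 * t)) (λ k → lastDoubled (2 * t) (toℕ k) ℤ.* dSeq F (idx k))
        ≤⟨ ℤP.+-monoʳ-≤ (+ (2 * n)) (alternatingDoubled≤ 2dSeq≤Φ (2 * t) (isEven-double t) idx
                                       (λ k l → <⇒≤ ∘ increasing k l) ≤-refl) ⟩
      + (2 * n) ℤ.+ Φ (toℕ (idx zero))
        ≤⟨ 2n+Φ≤L (idx zero) ⟩
      + horizBoundary F ∎

    bound₂ : + (2 * n) ℤ.+ ∑ℤ (suc (2 * t)) (λ k → coeff₂ t k ℤ.* dSeq F (idx k))
             ℤ.≤ + horizBoundary F
    bound₂ = begin
      -- the sum of the statement, unfolded by computation
      + (2 * n) ℤ.+ (ℤ.- + 2 ℤ.* d₀ ℤ.+ ∑ℤ (2 * t) (λ k → sign (toℕ k) ℤ.* dSeq F (idx (suc k))))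
        ≤⟨ ℤP.+-monoʳ-≤ (+ (2 * n)) (ℤP.+-monoʳ-≤ (ℤ.- + 2 ℤ.* d₀)
             (alternating≤ (λ _ → ℤ.+≤+ z≤n) (2 * t) (isEven-double t) (idx ∘ suc)
                (λ k l k<l → <⇒≤ (increasing (suc k) (suc l) (s≤s k<l)))
                (λ k → <⇒≤ (increasing zero (suc k) (s≤s z≤n))))) ⟩
      + (2 * n) ℤ.+ (ℤ.- + 2 ℤ.* d₀ ℤ.+ Φ (toℕ (idx zero)))
        ≤⟨ 2n-2dSeq+Φ≤L (idx zero) ⟩
      + horizBoundary F ∎
      where
      d₀ : ℤ
      d₀ = dSeq F (idx zero)

open import Data.Nat using (ℕ; suc; _≤_; _*_)
open import Data.Fin using (Fin; zero; fromℕ; _<_)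
open import Data.Integer as ℤ using (ℤ; +_)
open import Data.Product using (_×_; _,_)
open import Relation.Binary.PropositionalEquality using (_≡_)

theorem3p1 : (m′ n : ℕ) → 1 ≤ n → (F : Image (suc m′) n) →
    rowSum F zero ≡ n → rowSum F (fromℕ m′) ≡ 0 →
    (t : ℕ) → (idx : Fin (suc (2 * t)) → Fin (suc m′)) →
    (∀ k l → k < l → idx k < idx l) →
    ((+ (2 * n) ℤ.+ ∑ℤ (suc (2 * t)) (λ k → coeff₁ t k ℤ.* dSeq F (idx k)))
    ℤ.≤ + horizBoundary F)
    × ((+ (2 * n) ℤ.+ ∑ℤ (suc (2 * t)) (λ k → coeff₂ t k ℤ.* dSeq F (idx k)))
    ℤ.≤ + horizBoundary F)
theorem3p1 m′ n _ F topRow _ t idx increasing = bound₁ t idx increasing , bound₂ t idx increasing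
  where open ImageBounds F topRow
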